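{- Let $n\ge 2$. The set $\mathcal{F}^{1}_{n,2}$ is in bijection with the set $\mathcal{M}_{n-1}$ of magog triangles of size $n-1$. In particular $|\mathcal{F}^{1}_{n,2}| = |\mathcal{M}_{n-1}|$.
   Context: Let $[n]=\{1,\ldots,n\}$. The ground set of the poset $F_{n,2}$ consists of $\emptyset$ and all subsets of $[n]$ of size $1$ or $2$. Identify each nonempty such set $S$ with the pair $(a,b)$, where $a=\max S$ and $b$ is the other element of $S$ if $|S|=2$ and $b=0$ if $|S|=1$. The order of $F_{n,2}$: $\emptyset$ is the minimum, and $(a,b)\preceq(c,d)$ iff $a\le c$ and $b\le d$. A refinement of a poset is a partial order on the same ground set whose order relation contains the original one. $\mathcal{F}^{1}_{n,2}$ is the set of partial orders $P$ on the ground set of $F_{n,2}$ such that (i) $P$ refines $F_{n,2}$, (ii) every singleton set $\{i\}$ is comparable in $P$ with every element, and (iii) $P$ is minimal with respect to inclusion of order relations among all partial orders satisfying (i) and (ii). A magog triangle of size $m$ is an array of positive integers $M(i,j)$, $1\le j\le i\le m$, such that $1\le M(i,j)\le j$; $M(i,j)\le M(i+1,j)$ whenever both are defined (columns weakly increasing); and $M(i,j)\le M(i,j+1)$ whenever both are defined (rows weakly increasing). $\mathcal{M}_m$ denotes the set of magog triangles of size $m$. -}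

module Defs where

open import Data.Nat using (ℕ; zero; suc; _≤_; _<_; _+_)
open import Data.Fin using (Fin; toℕ) renaming (zero to fzero)
open import Data.Bool using (Bool; T)
open import Data.Product using (Σ; _×_; _,_; proj₁)
open import Data.Sum using (_⊎_)
open import Data.Empty using (⊥)
open import Data.Unit using (⊤)
open import Relation.Binary.PropositionalEquality using (_≡_; refl; sym; trans)
open import Relation.Binary.Bundles using (Setoid)
open import Level using (0ℓ)

-- Ground set of F_{n,2}.
-- `∅` is the empty set.  `pair a b` (a : Fin n, b : Fin (suc (toℕ a)))
-- encodes the pair (a', b) of the paper with a' = toℕ a + 1 = max S ∈ [n]
-- and b = toℕ b ∈ {0,…,a'-1}; b = 0 means S = {a'}, otherwise S = {b, a'}.

data Elem (n : ℕ) : Set where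
  ∅    : Elem n
  pair : (a : Fin n) → Fin (suc (toℕ a)) → Elem n

singleton : {n : ℕ} → Fin n → Elem n
singleton i = pair i fzero

_≤F_ : {n : ℕ} → Elem n → Elem n → Set
∅ ≤F y = ⊤
pair a b ≤F ∅ = ⊥
pair a b ≤F pair c d = (toℕ a ≤ toℕ c) × (toℕ b ≤ toℕ d)

BRel : ℕ → Set
BRel n = Elem n → Elem n → Bool

IsPartialOrder : {n : ℕ} → BRel n → Set
IsPartialOrder {n} P =
  (∀ (x : Elem n) → T (P x x)) ×
  (∀ (x y : Elem n) → T (P x y) → T (P y x) → x ≡ y) ×
  (∀ (x y z : Elem n) → T (P x y) → T (P y z) → T (P x z))

_⊆R_ : {n : ℕ} → BRel n → BRel n → Set
_⊆R_ {n} P Q = ∀ (x y : Elem n) → T (P x y) → T (Q x y)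

Refines : {n : ℕ} → BRel n → Set
Refines {n} P = ∀ (x y : Elem n) → x ≤F y → T (P x y)

SingletonsComparable : {n : ℕ} → BRel n → Set
SingletonsComparable {n} P =
  ∀ (i : Fin n) (y : Elem n) → T (P (singleton i) y) ⊎ T (P y (singleton i))

Admissible : {n : ℕ} → BRel n → Set
Admissible P = IsPartialOrder P × Refines P × SingletonsComparable P

IsF1 : {n : ℕ} → BRel n → Set
IsF1 {n} P = Admissible P × (∀ (Q : BRel n) → Admissible Q → Q ⊆R P → P ⊆R Q)

F1Setoid : ℕ → Setoid 0ℓ 0ℓ
F1Setoid n = record
  { Carrier = Σ (BRel n) IsF1
  ; _≈_ = λ P Q → ∀ (x y : Elem n) → proj₁ P x y ≡ proj₁ Q x y
  ; isEquivalence = record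
    { refl = λ x y → refl
    ; sym = λ p x y → sym (p x y)
    ; trans = λ p q x y → trans (p x y) (q x y) } }

-- Magog triangles of size m: entries M i j for 1 ≤ j ≤ i ≤ m
-- (values of the function outside this range are irrelevant).

IsMagog : ℕ → (ℕ → ℕ → ℕ) → Set
IsMagog m M =
  (∀ i j → 1 ≤ j → j ≤ i → i ≤ m → (1 ≤ M i j) × (M i j ≤ j)) ×
  (∀ i j → 1 ≤ j → j ≤ i → i + 1 ≤ m → M i j ≤ M (i + 1) j) ×
  (∀ i j → 1 ≤ j → j + 1 ≤ i → i ≤ m → M i j ≤ M i (j + 1))

MagogSetoid : ℕ → Setoid 0ℓ 0ℓ
MagogSetoid m = record
  { Carrier = Σ (ℕ → ℕ → ℕ) (IsMagog m)
  ; _≈_ = λ M N → ∀ i j → 1 ≤ j → j ≤ i → i ≤ m → proj₁ M i j ≡ proj₁ N i j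
  ; isEquivalence = record
    { refl = λ i j _ _ _ → refl
    ; sym = λ p i j a b c → sym (p i j a b c)
    ; trans = λ p q i j a b c → trans (p i j a b c) (q i j a b c) } }

-- For P in 𝓕¹_{n,2} every singleton is comparable with every doubleton and the singletons form a
-- chain, so the singletons above a doubleton x form a final segment of it; one plus its length is
-- the weight of x. Placing the weight of {b+1, a+1} in cell (n-b-1, n-a) gives a magog: the bound
-- holds because the singletons {k+1} with k ≤ a lie below x in F_{n,2}, monotonicity by
-- transitivity. Conversely a magog prescribes which singletons lie above which doubletons; the
-- least admissible order with these relations (two doubletons are related iff they are related in
-- F_{n,2} or a singleton separates them) is minimal, and by minimality it is the only element of
-- 𝓕¹_{n,2} with these weights.

module Submission where

open import Data.Bool using (Bool; true; false; T)
open import Data.Bool.Properties using (⇔→≡; T-≡)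
open import Data.Empty using (⊥; ⊥-elim)
open import Data.Fin using (Fin; toℕ; fromℕ<) renaming (zero to fzero; suc to fsuc)
open import Data.Fin.Properties using (toℕ-injective; toℕ<n; toℕ-fromℕ<)
open import Data.Nat using (ℕ; zero; suc; _≤_; _<_; _≤′_; ≤′-reflexive; ≤′-step; _∸_; _+_; z≤n; s≤s; s≤s⁻¹; _≤?_; _<?_)
open import Data.Nat.Properties
open import Data.Product using (Σ; _×_; _,_; proj₁; proj₂)
open import Data.Sum as Sum using (_⊎_; inj₁; inj₂)
open import Data.Unit using (⊤; tt)
open import Defs
open import Function using (_∘_)
open import Function.Bundles using (Bijection; _⇔_; mk⇔; module Equivalence)
open import Function.Construct.Composition using (_⇔-∘_)
open import Function.Construct.Symmetry using (⇔-sym)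
open import Relation.Binary.PropositionalEquality
open import Relation.Nullary using (Dec; yes; no; contradiction)
open import Relation.Nullary.Decidable using (⌊_⌋; toWitness; fromWitness; _×-dec_; _⊎-dec_)

open Equivalence using (to; from)

T-⇔→≡ : ∀ {x y} → T x ⇔ T y → x ≡ y
T-⇔→≡ h = ⇔→≡ (T-≡ ⇔-∘ (h ⇔-∘ ⇔-sym T-≡))

boolToℕ : Bool → ℕ
boolToℕ true  = 1
boolToℕ false = 0

boolToℕ-mono : ∀ {x y} → (T x → T y) → boolToℕ x ≤ boolToℕ y
boolToℕ-mono {false}         _ = z≤n
boolToℕ-mono {true} {true}   _ = ≤-refl
boolToℕ-mono {true} {false}  h = ⊥-elim (h tt)

count : ∀ {n} → (Fin n → Bool) → ℕ
count {zero}  f = 0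
count {suc n} f = boolToℕ (f fzero) + count (f ∘ fsuc)

count-cong : ∀ {n} {f g : Fin n → Bool} → (∀ k → f k ≡ g k) → count f ≡ count g
count-cong {zero}  e = refl
count-cong {suc n} e = cong₂ _+_ (cong boolToℕ (e fzero)) (count-cong (e ∘ fsuc))

count-mono : ∀ {n} {f g : Fin n → Bool} → (∀ k → T (f k) → T (g k)) → count f ≤ count g
count-mono {zero}  h = z≤n
count-mono {suc n} h = +-mono-≤ (boolToℕ-mono (h fzero)) (count-mono (h ∘ fsuc))

count≤n : ∀ {n} (f : Fin n → Bool) → count f ≤ n
count≤n {zero}  f = z≤n
count≤n {suc n} f = +-mono-≤ (boolToℕ-mono {y = true} λ _ → tt) (count≤n (f ∘ fsuc))

count≤n∸ : ∀ {n} m {f : Fin n → Bool} → (∀ k → T (f k) → m ≤ toℕ k) → count f ≤ n ∸ m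
count≤n∸         zero    {f} _ = count≤n f
count≤n∸ {zero}  (suc m)     _ = z≤n
count≤n∸ {suc n} (suc m)     h =
  +-mono-≤ (boolToℕ-mono {y = false} (λ t → contradiction (h fzero t) λ ()))
           (count≤n∸ m (λ k t → s≤s⁻¹ (h (fsuc k) t)))

count-all : ∀ {n} {f : Fin n → Bool} → (∀ k → T (f k)) → count f ≡ n
count-all {zero}          _ = refl
count-all {suc n} {f} h with f fzero | h fzero
... | true  | _  = cong suc (count-all (h ∘ fsuc))
... | false | ()

UpwardClosed : ∀ {n} → (Fin n → Bool) → Set
UpwardClosed f = ∀ {k k'} → toℕ k ≤ toℕ k' → T (f k) → T (f k')

upwardClosed-threshold : ∀ {n} {f : Fin n → Bool} → UpwardClosed f →
                         ∀ k → T (f k) ⇔ n ≤ toℕ k + count f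
upwardClosed-threshold {suc n} {f} up k with f fzero in f0≡b
... | true  = mk⇔ (λ _ → ≤-trans (≤-reflexive (cong suc (sym (count-all λ _ → up z≤n f0))))
                                (m≤n+m _ (toℕ k)))
                  (λ _ → up z≤n f0)
  where f0 : T (f fzero)
        f0 = subst T (sym f0≡b) tt
... | false = threshold k
  where
    threshold : ∀ k → T (f k) ⇔ suc n ≤ toℕ k + count (f ∘ fsuc)
    threshold fzero    = mk⇔ (λ t → contradiction (subst T f0≡b t) λ ())
                             (λ p → contradiction p (≤⇒≯ (count≤n (f ∘ fsuc))))
    threshold (fsuc k) = mk⇔ (s≤s ∘ to ih) (from ih ∘ s≤s⁻¹)
      where ih = upwardClosed-threshold (up ∘ s≤s) k

count-threshold : ∀ {n c} {f : Fin n → Bool} → c ≤ n → (∀ k → T (f k) ⇔ n ≤ toℕ k + c) →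
                  count f ≡ c
count-threshold {zero}        c≤n _ = sym (n≤0⇒n≡0 c≤n)
count-threshold {suc n} {f = f} c≤n h with m≤n⇒m<n∨m≡n c≤n
... | inj₂ refl = count-all λ k → from (h k) (m≤n+m _ (toℕ k))
... | inj₁ (s≤s c≤n') with f fzero in f0≡b
...   | true  = contradiction (to (h fzero) (subst T (sym f0≡b) tt)) (<⇒≱ (s≤s c≤n'))
...   | false = count-threshold c≤n' λ k → mk⇔ (s≤s⁻¹ ∘ to (h (fsuc k))) (from (h (fsuc k)) ∘ s≤s)

pair-cong : ∀ {n} {a a' : Fin n} {b : Fin (suc (toℕ a))} {b' : Fin (suc (toℕ a'))} →
            toℕ a ≡ toℕ a' → toℕ b ≡ toℕ b' → pair a b ≡ pair a' b'
pair-cong {a = a} {a'} a≡a' b≡b' with toℕ-injective {i = a} {j = a'} a≡a'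
... | refl = cong (pair a) (toℕ-injective b≡b')

-- The element pair a b, i.e. {b, a+1} ({a+1} when b = 0), from natural-number indices, with
-- the junk value ∅ when a < n or b ≤ a fails.
elemAt : (n a b : ℕ) → Elem n
elemAt n a b with a <? n | b ≤? a
... | yes a<n | yes b≤a = pair (fromℕ< a<n) (fromℕ< (s≤s (subst (b ≤_) (sym (toℕ-fromℕ< a<n)) b≤a)))
... | _       | _       = ∅

elemAt-pair : ∀ {n} (a : Fin n) (b : Fin (suc (toℕ a))) → elemAt n (toℕ a) (toℕ b) ≡ pair a b
elemAt-pair {n} a b with toℕ a <? n | toℕ b ≤? toℕ a
... | yes _   | yes _   = pair-cong (toℕ-fromℕ< _) (toℕ-fromℕ< _)
... | no a≮n  | _       = contradiction (toℕ<n a) a≮n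
... | yes _   | no b≰a  = contradiction (s≤s⁻¹ (toℕ<n b)) b≰a

elemAt-doubleton : ∀ {n a b} → a < n → 1 ≤ b → b ≤ a →
  Σ (Fin n) λ a' → Σ (Fin (toℕ a')) λ b' →
    elemAt n a b ≡ pair a' (fsuc b') × toℕ a' ≡ a × suc (toℕ b') ≡ b
elemAt-doubleton {n} {a} {suc b} a<n _ b<a = a' , b' , elemAt≡ , a'≡a , cong suc b'≡b
  where
    a' = fromℕ< a<n
    a'≡a = toℕ-fromℕ< a<n
    b' = fromℕ< (subst (b <_) (sym a'≡a) b<a)
    b'≡b = toℕ-fromℕ< (subst (b <_) (sym a'≡a) b<a)
    elemAt≡ : elemAt n a (suc b) ≡ pair a' (fsuc b')
    elemAt≡ = begin
      elemAt n a (suc b)                   ≡⟨ cong₂ (λ x y → elemAt n x (suc y)) (sym a'≡a) (sym b'≡b) ⟩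
      elemAt n (toℕ a') (toℕ (fsuc b'))   ≡⟨ elemAt-pair a' (fsuc b') ⟩
      pair a' (fsuc b')                    ∎
      where open ≡-Reasoning

triangle-doubleton : ∀ {n i j} → 1 ≤ j → j ≤ i → i ≤ n ∸ 1 →
  Σ (Fin n) λ a → Σ (Fin (toℕ a)) λ b →
    elemAt n (n ∸ j) (n ∸ i) ≡ pair a (fsuc b) × toℕ a ≡ n ∸ j × suc (toℕ b) ≡ n ∸ i
triangle-doubleton {zero}  (s≤s _) (s≤s _) ()
triangle-doubleton {suc n} 1≤j j≤i i≤n =
  elemAt-doubleton (∸-monoʳ-< 1≤j (≤-trans j≤i (m≤n⇒m≤1+n i≤n))) (m<n⇒0<n∸m (s≤s i≤n)) (∸-monoʳ-≤ _ j≤i)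

module MagogMonotone {m : ℕ} {M : ℕ → ℕ → ℕ} (mag : IsMagog m M) where

  column-step : ∀ {i j} → 1 ≤ j → j ≤ i → suc i ≤ m → M i j ≤ M (suc i) j
  column-step {i} {j} 1≤j j≤i i<m = subst (λ i' → M i j ≤ M i' j) (+-comm i 1)
    (proj₁ (proj₂ mag) i j 1≤j j≤i (subst (_≤ m) (+-comm 1 i) i<m))

  row-step : ∀ {i j} → 1 ≤ j → suc j ≤ i → i ≤ m → M i j ≤ M i (suc j)
  row-step {i} {j} 1≤j j<i i≤m = subst (λ j' → M i j ≤ M i j') (+-comm j 1)
    (proj₂ (proj₂ mag) i j 1≤j (subst (_≤ i) (+-comm 1 j) j<i) i≤m)

  column-mono : ∀ {i i' j} → 1 ≤ j → j ≤ i → i ≤′ i' → i' ≤ m → M i j ≤ M i' j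
  column-mono _   _   (≤′-reflexive refl) _    = ≤-refl
  column-mono 1≤j j≤i (≤′-step i≤′i')     i'<m =
    ≤-trans (column-mono 1≤j j≤i i≤′i' (<⇒≤ i'<m)) (column-step 1≤j (≤-trans j≤i (≤′⇒≤ i≤′i')) i'<m)

  row-mono : ∀ {i j j'} → 1 ≤ j → j ≤′ j' → j' ≤ i → i ≤ m → M i j ≤ M i j'
  row-mono _   (≤′-reflexive refl) _    _   = ≤-refl
  row-mono 1≤j (≤′-step j≤′j')     j'<i i≤m =
    ≤-trans (row-mono 1≤j j≤′j' (<⇒≤ j'<i) i≤m) (row-step (≤-trans 1≤j (≤′⇒≤ j≤′j')) j'<i i≤m)

  magog-mono : ∀ {i i' j j'} → 1 ≤ j → j ≤ i → j' ≤ i' → i' ≤ m → i ≤ i' → j ≤ j' → M i j ≤ M i' j'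
  magog-mono 1≤j j≤i j'≤i' i'≤m i≤i' j≤j' =
    ≤-trans (column-mono 1≤j j≤i (≤⇒≤′ i≤i') i'≤m) (row-mono 1≤j (≤⇒≤′ j≤j') j'≤i' i'≤m)

weight : ∀ {n} → (ℕ → ℕ → ℕ) → (a : Fin n) → Fin (toℕ a) → ℕ
weight {n} M a b = M (n ∸ suc (toℕ b)) (n ∸ toℕ a)

doubleton-cell : ∀ {n} (a : Fin n) (b : Fin (toℕ a)) →
  1 ≤ n ∸ toℕ a × n ∸ toℕ a ≤ n ∸ suc (toℕ b) × n ∸ suc (toℕ b) ≤ n ∸ 1
doubleton-cell {n} a b = m<n⇒0<n∸m (toℕ<n a) , ∸-monoʳ-≤ n (toℕ<n b) , ∸-monoʳ-≤ n (s≤s z≤n)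

atDoubleton : ∀ {n} {A : ℕ → ℕ → Set} → (∀ i j → 1 ≤ j → j ≤ i → i ≤ n ∸ 1 → A i j) →
              (a : Fin n) (b : Fin (toℕ a)) → A (n ∸ suc (toℕ b)) (n ∸ toℕ a)
atDoubleton h a b = let 1≤j , j≤i , i≤m = doubleton-cell a b in h _ _ 1≤j j≤i i≤m

module MagogWeight {n : ℕ} {M : ℕ → ℕ → ℕ} (mag : IsMagog (n ∸ 1) M) where
  open MagogMonotone mag

  weight≥1 : ∀ a b → 1 ≤ weight M a b
  weight≥1 = atDoubleton {n} λ i j 1≤j j≤i i≤m → proj₁ (proj₁ mag i j 1≤j j≤i i≤m)

  weight-bound : ∀ a b → toℕ a + weight M a b ≤ n
  weight-bound a b = begin
    toℕ a + weight M a b  ≤⟨ +-monoʳ-≤ (toℕ a) (atDoubleton {n} (λ i j p q r → proj₂ (proj₁ mag i j p q r)) a b) ⟩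
    toℕ a + (n ∸ toℕ a)   ≡⟨ m+[n∸m]≡n (<⇒≤ (toℕ<n a)) ⟩
    n                     ∎
    where open ≤-Reasoning

  weight-antitone : ∀ {a b c d} → toℕ a ≤ toℕ c → toℕ b ≤ toℕ d → weight M c d ≤ weight M a b
  weight-antitone {a} {b} {c} {d} a≤c b≤d =
    let 1≤j , j≤i , _ = doubleton-cell c d
        _ , j'≤i' , i'≤m = doubleton-cell a b
    in magog-mono 1≤j j≤i j'≤i' i'≤m (∸-monoʳ-≤ n (s≤s b≤d)) (∸-monoʳ-≤ n a≤c)

separating-index : ∀ {n v w} → 1 ≤ v → v < w → w ≤ n → Σ (Fin n) λ k → n < toℕ k + w × toℕ k + v ≤ n
separating-index {n} {v} {suc w} 1≤v v<w w<n = fromℕ< n∸w<n , above , below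
  where
    v≤w = s≤s⁻¹ v<w
    n∸w<n = ∸-monoʳ-< (≤-trans 1≤v v≤w) (<⇒≤ w<n)
    k≡n∸w = toℕ-fromℕ< n∸w<n
    above : n < toℕ (fromℕ< n∸w<n) + suc w
    above rewrite k≡n∸w | +-suc (n ∸ w) w | m∸n+n≡m (<⇒≤ w<n) = ≤-refl
    below : toℕ (fromℕ< n∸w<n) + v ≤ n
    below rewrite k≡n∸w = ≤-trans (+-monoʳ-≤ (n ∸ w) v≤w) (≤-reflexive (m∸n+n≡m (<⇒≤ w<n)))

-- The least admissible order in which the singleton {c+1} lies above a doubleton of weight w
-- exactly when n < c + w.
module MagogOrder {n : ℕ} (M : ℕ → ℕ → ℕ) where

  infix 4 _⊑_ _⊑?_

  _⊑_ : Elem n → Elem n → Set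
  ∅        ⊑ _        = ⊤
  pair _ _ ⊑ ∅        = ⊥
  pair a fzero    ⊑ pair c fzero    = toℕ a ≤ toℕ c
  pair a fzero    ⊑ pair c (fsuc d) = toℕ a + weight M c d ≤ n
  pair a (fsuc b) ⊑ pair c fzero    = n < toℕ c + weight M a b
  pair a (fsuc b) ⊑ pair c (fsuc d) = toℕ a ≤ toℕ c × toℕ b ≤ toℕ d ⊎ weight M c d < weight M a b

  _⊑?_ : ∀ x y → Dec (x ⊑ y)
  ∅        ⊑? _        = yes tt
  pair _ _ ⊑? ∅        = no λ ()
  pair a fzero    ⊑? pair c fzero    = toℕ a ≤? toℕ c
  pair a fzero    ⊑? pair c (fsuc d) = toℕ a + weight M c d ≤? n
  pair a (fsuc b) ⊑? pair c fzero    = n <? toℕ c + weight M a b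
  pair a (fsuc b) ⊑? pair c (fsuc d) =
    toℕ a ≤? toℕ c ×-dec toℕ b ≤? toℕ d ⊎-dec weight M c d <? weight M a b

  order : BRel n
  order x y = ⌊ x ⊑? y ⌋

  order⇒⊑ : ∀ {x y} → T (order x y) → x ⊑ y
  order⇒⊑ {x} {y} = toWitness {a? = x ⊑? y}

  ⊑⇒order : ∀ {x y} → x ⊑ y → T (order x y)
  ⊑⇒order {x} {y} = fromWitness {a? = x ⊑? y}

  MatchesWeights : BRel n → Set
  MatchesWeights Q = ∀ a b c → T (Q (pair a (fsuc b)) (singleton c)) ⇔ n < toℕ c + weight M a b

  module _ (mag : IsMagog (n ∸ 1) M) where
    open MagogWeight {n} mag

    weight-antitone-⊑ : ∀ {a b c d} → pair a (fsuc b) ⊑ pair c (fsuc d) → weight M c d ≤ weight M a b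
    weight-antitone-⊑ (inj₁ (a≤c , b≤d)) = weight-antitone a≤c b≤d
    weight-antitone-⊑ (inj₂ w<w')        = <⇒≤ w<w'

    ⊑-refl : ∀ x → x ⊑ x
    ⊑-refl ∅               = tt
    ⊑-refl (pair a fzero)    = ≤-refl
    ⊑-refl (pair a (fsuc b)) = inj₁ (≤-refl , ≤-refl)

    ⊑-antisym : ∀ x y → x ⊑ y → y ⊑ x → x ≡ y
    ⊑-antisym ∅ ∅ _ _ = refl
    ⊑-antisym (pair a fzero)    (pair c fzero)    a≤c c≤a = pair-cong (≤-antisym a≤c c≤a) refl
    ⊑-antisym (pair a fzero)    (pair c (fsuc d)) p q = contradiction p (<⇒≱ q)
    ⊑-antisym (pair a (fsuc b)) (pair c fzero)    p q = contradiction q (<⇒≱ p)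
    ⊑-antisym (pair a (fsuc b)) (pair c (fsuc d)) (inj₁ (a≤c , b≤d)) (inj₁ (c≤a , d≤b)) =
      pair-cong (≤-antisym a≤c c≤a) (cong suc (≤-antisym b≤d d≤b))
    ⊑-antisym (pair a (fsuc b)) (pair c (fsuc d)) p (inj₂ w<w') = contradiction (weight-antitone-⊑ p) (<⇒≱ w<w')
    ⊑-antisym (pair a (fsuc b)) (pair c (fsuc d)) (inj₂ w<w') q = contradiction (weight-antitone-⊑ q) (<⇒≱ w<w')

    ⊑-trans : ∀ x y z → x ⊑ y → y ⊑ z → x ⊑ z
    ⊑-trans ∅ _ _ _ _ = tt
    ⊑-trans (pair a fzero) (pair c fzero) (pair e fzero) p q = ≤-trans p q
    ⊑-trans (pair a fzero) (pair c fzero) (pair e (fsuc f)) p q = ≤-trans (+-monoˡ-≤ _ p) q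
    ⊑-trans (pair a fzero) (pair c (fsuc d)) (pair e fzero) p q =
      <⇒≤ (+-cancelʳ-< _ (toℕ a) (toℕ e) (≤-<-trans p q))
    ⊑-trans (pair a fzero) (pair c (fsuc d)) (pair e (fsuc f)) p q =
      ≤-trans (+-monoʳ-≤ (toℕ a) (weight-antitone-⊑ q)) p
    ⊑-trans (pair a (fsuc b)) (pair c fzero) (pair e fzero) p q = <-≤-trans p (+-monoˡ-≤ _ q)
    ⊑-trans (pair a (fsuc b)) (pair c fzero) (pair e (fsuc f)) p q =
      inj₂ (+-cancelˡ-< (toℕ c) _ _ (≤-<-trans q p))
    ⊑-trans (pair a (fsuc b)) (pair c (fsuc d)) (pair e fzero) p q =
      <-≤-trans q (+-monoʳ-≤ (toℕ e) (weight-antitone-⊑ p))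
    ⊑-trans (pair a (fsuc b)) (pair c (fsuc d)) (pair e (fsuc f)) (inj₁ (a≤c , b≤d)) (inj₁ (c≤e , d≤f)) =
      inj₁ (≤-trans a≤c c≤e , ≤-trans b≤d d≤f)
    ⊑-trans (pair a (fsuc b)) (pair c (fsuc d)) (pair e (fsuc f)) p (inj₂ w<w') =
      inj₂ (<-≤-trans w<w' (weight-antitone-⊑ p))
    ⊑-trans (pair a (fsuc b)) (pair c (fsuc d)) (pair e (fsuc f)) (inj₂ w<w') q =
      inj₂ (≤-<-trans (weight-antitone-⊑ q) w<w')

    ≤F⇒⊑ : ∀ x y → x ≤F y → x ⊑ y
    ≤F⇒⊑ ∅ _ _ = tt
    ≤F⇒⊑ (pair a fzero)    (pair c fzero)    (a≤c , _)   = a≤c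
    ≤F⇒⊑ (pair a fzero)    (pair c (fsuc d)) (a≤c , _)   = ≤-trans (+-monoˡ-≤ _ a≤c) (weight-bound c d)
    ≤F⇒⊑ (pair a (fsuc b)) (pair c (fsuc d)) (a≤c , b<d) = inj₁ (a≤c , s≤s⁻¹ b<d)

    singleton-comparable : ∀ i y → singleton i ⊑ y ⊎ y ⊑ singleton i
    singleton-comparable i ∅                 = inj₂ tt
    singleton-comparable i (pair c fzero)    = ≤-total (toℕ i) (toℕ c)
    singleton-comparable i (pair c (fsuc d)) with toℕ i + weight M c d ≤? n
    ... | yes i+w≤n = inj₁ i+w≤n
    ... | no  i+w≰n = inj₂ (≰⇒> i+w≰n)

    order-admissible : Admissible order
    order-admissible =
      ( (λ x → ⊑⇒order (⊑-refl x))
      , (λ x y p q → ⊑-antisym x y (order⇒⊑ p) (order⇒⊑ q))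
      , (λ x y z p q → ⊑⇒order (⊑-trans x y z (order⇒⊑ p) (order⇒⊑ q))))
      , (λ x y x≤y → ⊑⇒order (≤F⇒⊑ x y x≤y))
      , λ i y → Sum.map ⊑⇒order ⊑⇒order (singleton-comparable i y)

    order-least : ∀ {Q} → Admissible Q → MatchesWeights Q → order ⊆R Q
    order-least {Q} ((_ , _ , Q-trans) , Q-refines , Q-comparable) matches x y = least x y ∘ order⇒⊑
      where
        singleton-below-doubleton : ∀ i c d → toℕ i + weight M c d ≤ n →
                                    T (Q (singleton i) (pair c (fsuc d)))
        singleton-below-doubleton i c d i+w≤n with Q-comparable i (pair c (fsuc d))
        ... | inj₁ below = below
        ... | inj₂ above = contradiction (to (matches c d i) above) (≤⇒≯ i+w≤n)

        least : ∀ x y → x ⊑ y → T (Q x y)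
        least ∅ y _ = Q-refines ∅ y tt
        least (pair a fzero)    (pair c fzero)    a≤c  = Q-refines _ _ (a≤c , z≤n)
        least (pair a fzero)    (pair c (fsuc d)) a+w≤n = singleton-below-doubleton a c d a+w≤n
        least (pair a (fsuc b)) (pair c fzero)    n<c+w = from (matches a b c) n<c+w
        least (pair a (fsuc b)) (pair c (fsuc d)) (inj₁ (a≤c , b≤d)) = Q-refines _ _ (a≤c , s≤s b≤d)
        least (pair a (fsuc b)) (pair c (fsuc d)) (inj₂ w<w')
          with separating-index (weight≥1 c d) w<w' (m+n≤o⇒n≤o (toℕ a) (weight-bound a b))
        ... | k , n<k+w , k+w'≤n =
          Q-trans _ (singleton k) _ (from (matches a b k) n<k+w) (singleton-below-doubleton k c d k+w'≤n)

    order-isF1 : IsF1 order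
    order-isF1 = order-admissible , minimal
      where
        minimal : ∀ Q → Admissible Q → Q ⊆R order → order ⊆R Q
        minimal Q adQ@(_ , _ , Q-comparable) Q⊆order = order-least adQ matches
          where
            matches : MatchesWeights Q
            matches a b c = mk⇔ (order⇒⊑ {pair a (fsuc b)} {singleton c} ∘ Q⊆order _ _) doubleton-below
              where
                doubleton-below : n < toℕ c + weight M a b → T (Q (pair a (fsuc b)) (singleton c))
                doubleton-below n<c+w with Q-comparable c (pair a (fsuc b))
                ... | inj₁ above = contradiction (order⇒⊑ {singleton c} {pair a (fsuc b)} (Q⊆order _ _ above)) (<⇒≱ n<c+w)
                ... | inj₂ below = below

    order-unique : ∀ {P} → IsF1 P → MatchesWeights P → ∀ x y → P x y ≡ order x y
    order-unique (adP , P-minimal) matches x y =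
      T-⇔→≡ (mk⇔ (P-minimal order order-admissible order⊆P x y) (order⊆P x y))
      where order⊆P = order-least adP matches

open MagogOrder using (order; MatchesWeights; order-isF1; order-unique)

MatchesWeights-transfer : ∀ {n} {M M' : ℕ → ℕ → ℕ} {Q : BRel n} →
  (∀ i j → 1 ≤ j → j ≤ i → i ≤ n ∸ 1 → M i j ≡ M' i j) → MatchesWeights M Q → MatchesWeights M' Q
MatchesWeights-transfer {n} {Q = Q} M≈M' matches a b c =
  subst (λ w → T (Q (pair a (fsuc b)) (singleton c)) ⇔ n < toℕ c + w) (atDoubleton {n} M≈M' a b) (matches a b c)

≤+⇔<+suc : ∀ {n m k} → n ≤ m + k ⇔ n < m + suc k
≤+⇔<+suc {n} {m} {k} = mk⇔ (λ p → subst (n <_) (sym (+-suc m k)) (s≤s p))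
                            (λ p → s≤s⁻¹ (subst (n <_) (+-suc m k) p))

singletonsAbove : ∀ {n} → BRel n → Elem n → ℕ
singletonsAbove P x = count λ k → P x (singleton k)

magogOf : ∀ {n} → BRel n → ℕ → ℕ → ℕ
magogOf {n} P i j = suc (singletonsAbove P (elemAt n (n ∸ j) (n ∸ i)))

magogOf-cong : ∀ {n} {P P' : BRel n} → (∀ x y → P x y ≡ P' x y) → ∀ i j → magogOf P i j ≡ magogOf P' i j
magogOf-cong P≈P' i j = cong suc (count-cong λ k → P≈P' _ (singleton k))

weight-magogOf : ∀ {n} (P : BRel n) a b → weight (magogOf P) a b ≡ suc (singletonsAbove P (pair a (fsuc b)))
weight-magogOf {n} P a b = cong (suc ∘ singletonsAbove P) (begin
  elemAt n (n ∸ (n ∸ toℕ a)) (n ∸ (n ∸ suc (toℕ b)))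
    ≡⟨ cong₂ (elemAt n) (m∸[m∸n]≡n a≤n) (m∸[m∸n]≡n (≤-trans (toℕ<n b) a≤n)) ⟩
  elemAt n (toℕ a) (toℕ (fsuc b))
    ≡⟨ elemAt-pair a (fsuc b) ⟩
  pair a (fsuc b)
    ∎)
  where
    open ≡-Reasoning
    a≤n = <⇒≤ (toℕ<n a)

module AdmissibleOrder {n : ℕ} (P : BRel n) (adP : Admissible P) where
  P-antisym = proj₁ (proj₂ (proj₁ adP))
  P-trans   = proj₂ (proj₂ (proj₁ adP))
  P-refines = proj₁ (proj₂ adP)

  singletonsAbove-antitone : ∀ {x y} → x ≤F y → singletonsAbove P y ≤ singletonsAbove P x
  singletonsAbove-antitone x≤y = count-mono λ k → P-trans _ _ (singleton k) (P-refines _ _ x≤y)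

  singletonsAbove-doubleton : ∀ a b → suc (singletonsAbove P (pair a (fsuc b))) ≤ n ∸ toℕ a
  singletonsAbove-doubleton a b = begin
    suc (singletonsAbove P (pair a (fsuc b)))  ≤⟨ s≤s (count≤n∸ (suc (toℕ a)) above⇒>) ⟩
    suc (n ∸ suc (toℕ a))                      ≡⟨ sym (+-∸-assoc 1 (toℕ<n a)) ⟩
    n ∸ toℕ a                                  ∎
    where
      open ≤-Reasoning
      above⇒> : ∀ k → T (P (pair a (fsuc b)) (singleton k)) → toℕ a < toℕ k
      above⇒> k above with toℕ k ≤? toℕ a
      ... | no  k≰a = ≰⇒> k≰a
      ... | yes k≤a with P-antisym _ _ (P-refines (singleton k) _ (k≤a , z≤n)) above
      ...   | ()

  magogOf-mono : ∀ {i i' j j'} → 1 ≤ j → j ≤ i → i ≤ n ∸ 1 → 1 ≤ j' → j' ≤ i' → i' ≤ n ∸ 1 →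
                 i ≤ i' → j ≤ j' → magogOf P i j ≤ magogOf P i' j'
  magogOf-mono {i} {i'} {j} {j'} 1≤j j≤i i≤m 1≤j' j'≤i' i'≤m i≤i' j≤j'
    with triangle-doubleton 1≤j j≤i i≤m | triangle-doubleton 1≤j' j'≤i' i'≤m
  ... | a , b , elemAt≡ , a≡ , b≡ | a' , b' , elemAt≡' , a'≡ , b'≡ = begin
    magogOf P i j                                  ≡⟨ cong (suc ∘ singletonsAbove P) elemAt≡ ⟩
    suc (singletonsAbove P (pair a (fsuc b)))      ≤⟨ s≤s (singletonsAbove-antitone d'≤d) ⟩
    suc (singletonsAbove P (pair a' (fsuc b')))    ≡⟨ cong (suc ∘ singletonsAbove P) (sym elemAt≡') ⟩
    magogOf P i' j'                                ∎
    where
      open ≤-Reasoning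
      d'≤d : pair a' (fsuc b') ≤F pair a (fsuc b)
      d'≤d = subst₂ _≤_ (sym a'≡) (sym a≡) (∸-monoʳ-≤ n j≤j') , subst₂ _≤_ (sym b'≡) (sym b≡) (∸-monoʳ-≤ n i≤i')

  magogOf-isMagog : IsMagog (n ∸ 1) (magogOf P)
  magogOf-isMagog = bounds , column , row
    where
      bounds : ∀ i j → 1 ≤ j → j ≤ i → i ≤ n ∸ 1 → 1 ≤ magogOf P i j × magogOf P i j ≤ j
      bounds i j 1≤j j≤i i≤m with triangle-doubleton 1≤j j≤i i≤m
      ... | a , b , elemAt≡ , a≡ , _ = s≤s z≤n , (begin
        magogOf P i j                              ≡⟨ cong (suc ∘ singletonsAbove P) elemAt≡ ⟩
        suc (singletonsAbove P (pair a (fsuc b)))  ≤⟨ singletonsAbove-doubleton a b ⟩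
        n ∸ toℕ a                                  ≡⟨ cong (n ∸_) a≡ ⟩
        n ∸ (n ∸ j)                                ≡⟨ m∸[m∸n]≡n (≤-trans j≤i (≤-trans i≤m (m∸n≤m n 1))) ⟩
        j                                          ∎)
        where open ≤-Reasoning
      column : ∀ i j → 1 ≤ j → j ≤ i → i + 1 ≤ n ∸ 1 → magogOf P i j ≤ magogOf P (i + 1) j
      column i j 1≤j j≤i i+1≤m = magogOf-mono 1≤j j≤i (≤-trans (m≤m+n i 1) i+1≤m)
        1≤j (≤-trans j≤i (m≤m+n i 1)) i+1≤m (m≤m+n i 1) ≤-refl
      row : ∀ i j → 1 ≤ j → j + 1 ≤ i → i ≤ n ∸ 1 → magogOf P i j ≤ magogOf P i (j + 1)
      row i j 1≤j j+1≤i i≤m = magogOf-mono 1≤j (≤-trans (m≤m+n j 1) j+1≤i) i≤m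
        (≤-trans 1≤j (m≤m+n j 1)) j+1≤i i≤m ≤-refl (m≤m+n j 1)

  matchesWeights-magogOf : MatchesWeights (magogOf P) P
  matchesWeights-magogOf a b c rewrite weight-magogOf P a b =
    ≤+⇔<+suc ⇔-∘ upwardClosed-threshold singletons-above-upward c
    where
      singletons-above-upward : UpwardClosed λ k → P (pair a (fsuc b)) (singleton k)
      singletons-above-upward k≤k' above = P-trans _ _ _ above (P-refines _ _ (k≤k' , z≤n))

suc-count-threshold : ∀ {n w} → 1 ≤ w → w ≤ n → suc (count {n} λ k → ⌊ n <? toℕ k + w ⌋) ≡ w
suc-count-threshold {n} {suc c} _ w≤n =
  cong suc (count-threshold (≤-trans (n≤1+n c) w≤n) λ k → ⇔-sym ≤+⇔<+suc ⇔-∘ mk⇔ toWitness fromWitness)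

magogOf-order : ∀ {n} {M : ℕ → ℕ → ℕ} → IsMagog (n ∸ 1) M →
                ∀ i j → 1 ≤ j → j ≤ i → i ≤ n ∸ 1 → magogOf (order {n} M) i j ≡ M i j
magogOf-order {n} {M} mag i j 1≤j j≤i i≤m with triangle-doubleton 1≤j j≤i i≤m
... | a , b , elemAt≡ , a≡ , b≡ = begin
  magogOf (order {n} M) i j                          ≡⟨ cong (suc ∘ singletonsAbove (order M)) elemAt≡ ⟩
  suc (singletonsAbove (order M) (pair a (fsuc b)))  ≡⟨ suc-count-threshold (weight≥1 a b) w≤n ⟩
  weight M a b                                       ≡⟨ cong₂ M (∸-involutive b≡ i≤n) (∸-involutive a≡ j≤n) ⟩
  M i j                                              ∎
  where
    open ≡-Reasoning
    open MagogWeight {n} mag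
    w≤n = m+n≤o⇒n≤o (toℕ a) (weight-bound a b)
    i≤n = ≤-trans i≤m (m∸n≤m n 1)
    j≤n = ≤-trans j≤i i≤n
    ∸-involutive : ∀ {x y} → x ≡ n ∸ y → y ≤ n → n ∸ x ≡ y
    ∸-involutive refl = m∸[m∸n]≡n

magogOf-injective : ∀ {n} {P P' : BRel n} → IsF1 P → IsF1 P' →
  (∀ i j → 1 ≤ j → j ≤ i → i ≤ n ∸ 1 → magogOf P i j ≡ magogOf P' i j) → ∀ x y → P x y ≡ P' x y
magogOf-injective {n} {P} {P'} P-F1@(adP , _) P'-F1@(adP' , _) M≈M' x y = begin
  P x y                  ≡⟨ order-unique _ mag P-F1 (matchesWeights-magogOf P adP) x y ⟩
  order (magogOf P) x y  ≡⟨ order-unique _ mag P'-F1 matches' x y ⟨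
  P' x y                 ∎
  where
    open ≡-Reasoning
    open AdmissibleOrder using (magogOf-isMagog; matchesWeights-magogOf)
    mag = magogOf-isMagog P adP
    matches' = MatchesWeights-transfer {Q = P'} (λ i j p q r → sym (M≈M' i j p q r))
                                                (matchesWeights-magogOf P' adP')

mainTheorem3 : (n : ℕ) → 2 ≤ n → Bijection (F1Setoid n) (MagogSetoid (n ∸ 1))
mainTheorem3 n _ = record
  { to        = λ (P , P-F1) → magogOf P , AdmissibleOrder.magogOf-isMagog P (proj₁ P-F1)
  ; cong      = λ {(P , _)} {(P' , _)} P≈P' i j _ _ _ → magogOf-cong {P = P} {P'} P≈P' i j
  ; bijective = (λ {(_ , P-F1)} {(_ , P'-F1)} → magogOf-injective P-F1 P'-F1) , surjective
  }
  where
    surjective : ∀ (M : Σ (ℕ → ℕ → ℕ) (IsMagog (n ∸ 1))) → Σ (Σ (BRel n) IsF1) λ P →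
      ∀ {Q : Σ (BRel n) IsF1} → (∀ x y → proj₁ Q x y ≡ proj₁ P x y) →
      ∀ i j → 1 ≤ j → j ≤ i → i ≤ n ∸ 1 → magogOf (proj₁ Q) i j ≡ proj₁ M i j
    surjective (M , mag) = (order M , order-isF1 M mag) , λ Q≈P i j 1≤j j≤i i≤m →
      trans (magogOf-cong Q≈P i j) (magogOf-order {n} mag i j 1≤j j≤i i≤m)
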